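{- FCFS is $O(\sqrt P)$-competitive for minimizing the $\ell_2$ norm of flow time: there is an absolute constant $C$ such that every instance satisfies $\sqrt{F(\mathcal{FCFS})}\le C\sqrt{P}\,\sqrt{F(\mathcal{OPT})}$.
   Context: A single machine and $n$ jobs; job $J_i$ has integer release time $r_i\ge0$ and integer processing time $p_i\ge1$. Unit slots $[t]=[t,t+1)$; a (preemptive) schedule assigns each slot to at most one job so that $J_i$ receives exactly $p_i$ slots, all with $t\ge r_i$. $c_i(\mathcal{S})$ is the completion time of $J_i$, $f_i(\mathcal{S})=c_i(\mathcal{S})-r_i$, $F(\mathcal{S})=\sum_i f_i(\mathcal{S})^2$, the $\ell_2$ norm of flow time is $\sqrt{F(\mathcal{S})}$, and $\mathcal{OPT}$ minimizes $F$. $P=\max_i p_i/\min_i p_i$. $\mathcal{FCFS}$ is the First-Come-First-Served schedule: jobs are processed non-preemptively in order of non-decreasing release time, never idling while some released job is unfinished. -}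

module Defs where

open import Data.Nat using (ℕ; zero; suc; _+_; _*_; _∸_; _≤_; _<_; _⊔_; _⊓_)
open import Data.Fin using (Fin; _≟_)
open import Data.Maybe using (Maybe; just; nothing)
open import Data.List using (List; tabulate; foldr)
open import Data.Nat.ListAction using (sum)
open import Relation.Binary.PropositionalEquality using (_≡_)
open import Relation.Nullary using (yes; no)

isJob : {n : ℕ} → Fin n → Maybe (Fin n) → ℕ
isJob i nothing = 0
isJob i (just j) with i ≟ j
... | yes _ = 1
... | no _  = 0

countBefore : {n : ℕ} → (ℕ → Maybe (Fin n)) → Fin n → ℕ → ℕ
countBefore a i zero = 0
countBefore a i (suc t) = countBefore a i t + isJob i (a t)

-- 1 + the last slot t < T assigned to i (0 if none)
lastEnd : {n : ℕ} → (ℕ → Maybe (Fin n)) → Fin n → ℕ → ℕ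
lastEnd a i zero = 0
lastEnd a i (suc t) with isJob i (a t)
... | zero  = lastEnd a i t
... | suc _ = suc t

-- A preemptive schedule on one machine with unit slots [t,t+1):
-- slot t is given to at most one job (assign t), all slots ≥ horizon are empty,
-- job i gets exactly p i slots, all at times t ≥ r i.
record Schedule {n : ℕ} (r p : Fin n → ℕ) : Set where
  field
    horizon  : ℕ
    assign   : ℕ → Maybe (Fin n)
    empty    : ∀ t → horizon ≤ t → assign t ≡ nothing
    exact    : ∀ i → countBefore assign i horizon ≡ p i
    released : ∀ i t → assign t ≡ just i → r i ≤ t
open Schedule public

completion : {n : ℕ} {r p : Fin n → ℕ} → Schedule r p → Fin n → ℕ
completion S i = lastEnd (assign S) i (horizon S)

flow : {n : ℕ} {r p : Fin n → ℕ} → Schedule r p → Fin n → ℕ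
flow {r = r} S i = completion S i ∸ r i

cost : {n : ℕ} {r p : Fin n → ℕ} → Schedule r p → ℕ
cost {n} S = sum (tabulate {n = n} (λ i → flow S i * flow S i))

finishedBy : {n : ℕ} {r p : Fin n → ℕ} → Schedule r p → Fin n → ℕ → Set
finishedBy {p = p} S i t = countBefore (assign S) i t ≡ p i

-- FCFS (with arbitrary tie-breaking among equal release times):
--  * never idle while some released job is unfinished,
--  * non-preemptive: the slots of each job form a contiguous block,
--  * order by release time: whenever job i runs, every job released strictly
--    earlier has already finished.
record IsFCFS {n : ℕ} {r p : Fin n → ℕ} (S : Schedule r p) : Set where
  field
    nonIdling     : ∀ t → assign S t ≡ nothing → ∀ i → r i ≤ t → finishedBy S i t
    nonPreemptive : ∀ i t s u → assign S t ≡ just i → assign S u ≡ just i →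
                    t ≤ s → s ≤ u → assign S s ≡ just i
    releaseOrder  : ∀ i j t → assign S t ≡ just i → r j < r i → finishedBy S j t

-- max_i p_i (0 for the empty instance)
maxP : {n : ℕ} → (Fin n → ℕ) → ℕ
maxP {n} p = foldr _⊔_ 0 (tabulate {n = n} p)

-- min_i p_i (1 for the empty instance, where it is irrelevant)
minP : {n : ℕ} → (Fin n → ℕ) → ℕ
minP {zero} p = 1
minP {suc n} p = foldr _⊓_ (p Fin.zero) (tabulate {n = suc n} p)
  where import Data.Fin as Fin

-- Charge flow time to time slots. For a schedule let D(t) be the residual flow Σ (c_i − t) over
-- the jobs released by t, and V(t) their unfinished work. Summing D over time gives
-- Σ f_i(f_i + 1)/2, which lies between F/2 and F. In every schedule V ≤ D, and V² ≤ 2·pmax·D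
-- since the work released by t drains by at most one unit per slot while each job contributes at
-- most pmax per slot until it completes. A non-idling schedule has the least unfinished work.
-- As FCFS serves jobs in release order without preemption, every job alive at t completes within
-- V(t) slots, and all alive jobs but the running one still have p_i ≥ pmin left, so
-- pmin·D_FCFS ≤ (pmin + V)·V. Hence pmin·D_FCFS(t) ≤ 3·pmax·D_S(t) for every schedule S, and
-- summing over t gives pmin·F(FCFS) ≤ 6·pmax·F(S).

module Submission where

open import Defs
open import Data.Nat
open import Data.Nat.Properties
open import Data.Fin as Fin using (Fin; zero; suc)
import Data.Fin.Properties as Finₚ
open import Data.Maybe using (Maybe; just; nothing)
open import Data.List using (tabulate; foldr)
import Data.Nat.ListAction as List
open import Data.Product using (∃-syntax; _,_; _×_; proj₁; proj₂)
open import Data.Sum using (inj₁; inj₂)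
open import Function using (_∘_; case_of_)
open import Relation.Nullary using (yes; no; contradiction)
open import Relation.Binary.PropositionalEquality
open import Algebra.Properties.Semiring.Sum +-*-semiring
  using (sum; sum-syntax; sum-cong-≗; sum-replicate-zero; ∑-distrib-+; *-distribˡ-sum; *-distribʳ-sum)
open import Algebra.Properties.CommutativeSemigroup *-commutativeSemigroup using (x∙yz≈y∙xz)
open import Algebra.Properties.CommutativeSemigroup +-commutativeSemigroup using () renaming (interchange to +-interchange)
open import Data.Nat.Solver using (module +-*-Solver)

𝟙[_≤_] : ℕ → ℕ → ℕ
𝟙[ a ≤ b ] with a ≤? b
... | yes _ = 1
... | no _  = 0

𝟙-yes : ∀ {a b} → a ≤ b → 𝟙[ a ≤ b ] ≡ 1
𝟙-yes {a} {b} a≤b with a ≤? b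
... | yes _  = refl
... | no a≰b = contradiction a≤b a≰b

∸-triangle : ∀ p {x y} → x ≤ y → p ∸ x ≤ (p ∸ y) + (y ∸ x)
∸-triangle p {x} {y} x≤y = m≤n+o⇒m∸n≤o p x (begin
  p                              ≤⟨ m≤n+m∸n p y ⟩
  y + (p ∸ y)                    ≡⟨ cong (_+ (p ∸ y)) (sym (m+[n∸m]≡n x≤y)) ⟩
  x + (y ∸ x) + (p ∸ y)          ≡⟨ +-assoc x (y ∸ x) (p ∸ y) ⟩
  x + ((y ∸ x) + (p ∸ y))        ≡⟨ cong (x +_) (+-comm (y ∸ x) (p ∸ y)) ⟩
  x + ((p ∸ y) + (y ∸ x))        ∎)
  where open ≤-Reasoning

sum-tabulate : ∀ {n} (f : Fin n → ℕ) → List.sum (tabulate f) ≡ ∑[ i < n ] f i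
sum-tabulate {zero}  f = refl
sum-tabulate {suc n} f = cong (f zero +_) (sum-tabulate (f ∘ suc))

sum-mono-≤ : ∀ {n} {f g : Fin n → ℕ} → (∀ i → f i ≤ g i) → ∑[ i < n ] f i ≤ ∑[ i < n ] g i
sum-mono-≤ {zero}  f≤g = z≤n
sum-mono-≤ {suc n} f≤g = +-mono-≤ (f≤g zero) (sum-mono-≤ (f≤g ∘ suc))

isJob-self : ∀ {n} (i : Fin n) → isJob i (just i) ≡ 1
isJob-self i with i Fin.≟ i
... | yes _  = refl
... | no i≢i = contradiction refl i≢i

isJob-other : ∀ {n} {i j : Fin n} → i ≢ j → isJob i (just j) ≡ 0
isJob-other {i = i} {j} i≢j with i Fin.≟ j
... | yes i≡j = contradiction i≡j i≢j
... | no _    = refl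

isJob≤1 : ∀ {n} (i : Fin n) x → isJob i x ≤ 1
isJob≤1 i nothing  = z≤n
isJob≤1 i (just j) with i Fin.≟ j
... | yes _ = ≤-refl
... | no _  = z≤n

isJob≡suc⇒just : ∀ {n} (i : Fin n) x {k} → isJob i x ≡ suc k → x ≡ just i
isJob≡suc⇒just i (just j) eq with i Fin.≟ j
... | yes i≡j = cong just (sym i≡j)

isJob-suc : ∀ {n} (i j : Fin n) → isJob (suc i) (just (suc j)) ≡ isJob i (just j)
isJob-suc i j = case i Fin.≟ j of λ where
  (yes refl) → trans (isJob-self (suc i)) (sym (isJob-self i))
  (no i≢j)   → trans (isJob-other (i≢j ∘ Finₚ.suc-injective)) (sym (isJob-other i≢j))

sum-isJob : ∀ {n} (w : Fin n → ℕ) k → ∑[ j < n ] (w j * isJob j (just k)) ≡ w k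
sum-isJob {suc n} w zero = begin
  w zero * isJob {suc n} zero (just zero) + ∑[ j < n ] (w (suc j) * 0) ≡⟨ cong₂ _+_ (cong (w zero *_) (isJob-self {suc n} zero)) (sum-cong-≗ (λ j → *-zeroʳ (w (suc j)))) ⟩
  w zero * 1 + ∑[ j < n ] 0                                     ≡⟨ cong₂ _+_ (*-identityʳ (w zero)) (sum-replicate-zero n) ⟩
  w zero + 0                                                    ≡⟨ +-identityʳ (w zero) ⟩
  w zero                                                        ∎
  where open ≡-Reasoning
sum-isJob {suc n} w (suc k) = begin
  w zero * 0 + ∑[ j < n ] (w (suc j) * isJob (suc j) (just (suc k))) ≡⟨ cong (w zero * 0 +_) (sum-cong-≗ (λ j → cong (w (suc j) *_) (isJob-suc j k))) ⟩
  w zero * 0 + ∑[ j < n ] (w (suc j) * isJob j (just k))             ≡⟨ cong₂ _+_ (*-zeroʳ (w zero)) (sum-isJob (w ∘ suc) k) ⟩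
  w (suc k)                                                          ∎
  where open ≡-Reasoning

sum-isJob-just : ∀ {n} (k : Fin n) → ∑[ j < n ] isJob j (just k) ≡ 1
sum-isJob-just k = trans (sum-cong-≗ (λ j → sym (*-identityˡ (isJob j (just k))))) (sum-isJob (λ _ → 1) k)

sum-isJob≤1 : ∀ {n} (x : Maybe (Fin n)) → ∑[ j < n ] isJob j x ≤ 1
sum-isJob≤1 {n} nothing  = ≤-trans (≤-reflexive (sum-replicate-zero n)) z≤n
sum-isJob≤1     (just k) = ≤-reflexive (sum-isJob-just k)

sumBelow : ℕ → (ℕ → ℕ) → ℕ
sumBelow zero    f = 0
sumBelow (suc m) f = sumBelow m f + f m

sumBelow-cong : ∀ m {f g : ℕ → ℕ} → (∀ k → k < m → f k ≡ g k) → sumBelow m f ≡ sumBelow m g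
sumBelow-cong zero    f≡g = refl
sumBelow-cong (suc m) f≡g = cong₂ _+_ (sumBelow-cong m (λ k k<m → f≡g k (m<n⇒m<1+n k<m))) (f≡g m ≤-refl)

sumBelow-mono-≤ : ∀ m {f g : ℕ → ℕ} → (∀ k → k < m → f k ≤ g k) → sumBelow m f ≤ sumBelow m g
sumBelow-mono-≤ zero    f≤g = z≤n
sumBelow-mono-≤ (suc m) f≤g = +-mono-≤ (sumBelow-mono-≤ m (λ k k<m → f≤g k (m<n⇒m<1+n k<m))) (f≤g m ≤-refl)

sumBelow-distrib-+ : ∀ m (f g : ℕ → ℕ) → sumBelow m (λ k → f k + g k) ≡ sumBelow m f + sumBelow m g
sumBelow-distrib-+ zero    f g = refl
sumBelow-distrib-+ (suc m) f g = begin
  sumBelow m (λ k → f k + g k) + (f m + g m)     ≡⟨ cong (_+ (f m + g m)) (sumBelow-distrib-+ m f g) ⟩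
  (sumBelow m f + sumBelow m g) + (f m + g m)    ≡⟨ +-interchange (sumBelow m f) (sumBelow m g) (f m) (g m) ⟩
  (sumBelow m f + f m) + (sumBelow m g + g m)    ∎
  where open ≡-Reasoning

*-distribˡ-sumBelow : ∀ m c (f : ℕ → ℕ) → c * sumBelow m f ≡ sumBelow m (λ k → c * f k)
*-distribˡ-sumBelow zero    c f = *-zeroʳ c
*-distribˡ-sumBelow (suc m) c f = trans (*-distribˡ-+ c (sumBelow m f) (f m)) (cong (_+ c * f m) (*-distribˡ-sumBelow m c f))

sumBelow-const : ∀ m c → sumBelow m (λ _ → c) ≡ m * c
sumBelow-const zero    c = refl
sumBelow-const (suc m) c = trans (cong (_+ c) (sumBelow-const m c)) (+-comm (m * c) c)

sumBelow-vanishing : ∀ m {f : ℕ → ℕ} → (∀ k → k < m → f k ≡ 0) → sumBelow m f ≡ 0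
sumBelow-vanishing m f≡0 = trans (sumBelow-cong m f≡0) (trans (sumBelow-const m 0) (*-zeroʳ m))

sumBelow≤length : ∀ m {f : ℕ → ℕ} → (∀ k → f k ≤ 1) → sumBelow m f ≤ m
sumBelow≤length m f≤1 = ≤-trans (sumBelow-mono-≤ m (λ k _ → f≤1 k)) (≤-reflexive (trans (sumBelow-const m 1) (*-identityʳ m)))

sumBelow-+ : ∀ a b (f : ℕ → ℕ) → sumBelow (a + b) f ≡ sumBelow a f + sumBelow b (λ k → f (a + k))
sumBelow-+ a zero    f = trans (cong (λ x → sumBelow x f) (+-identityʳ a)) (sym (+-identityʳ _))
sumBelow-+ a (suc b) f = begin
  sumBelow (a + suc b) f                                        ≡⟨ cong (λ x → sumBelow x f) (+-suc a b) ⟩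
  sumBelow (a + b) f + f (a + b)                                ≡⟨ cong (_+ f (a + b)) (sumBelow-+ a b f) ⟩
  sumBelow a f + sumBelow b (λ k → f (a + k)) + f (a + b)       ≡⟨ +-assoc (sumBelow a f) _ _ ⟩
  sumBelow a f + sumBelow (suc b) (λ k → f (a + k))             ∎
  where open ≡-Reasoning

sumBelow-monoˡ-≤ : ∀ {m d} (f : ℕ → ℕ) → m ≤ d → sumBelow m f ≤ sumBelow d f
sumBelow-monoˡ-≤ {m} {d} f m≤d = begin
  sumBelow m f                                         ≤⟨ m≤m+n _ _ ⟩
  sumBelow m f + sumBelow (d ∸ m) (λ k → f (m + k))    ≡⟨ sym (sumBelow-+ m (d ∸ m) f) ⟩
  sumBelow (m + (d ∸ m)) f                             ≡⟨ cong (λ x → sumBelow x f) (m+[n∸m]≡n m≤d) ⟩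
  sumBelow d f                                         ∎
  where open ≤-Reasoning

sumBelow-truncate : ∀ m d (f : ℕ → ℕ) → (∀ k → d ≤ k → f k ≡ 0) → sumBelow m f ≤ sumBelow d f
sumBelow-truncate m d f vanish with ≤-total m d
... | inj₁ m≤d = sumBelow-monoˡ-≤ f m≤d
... | inj₂ d≤m = ≤-reflexive (begin
  sumBelow m f                                         ≡⟨ cong (λ x → sumBelow x f) (sym (m+[n∸m]≡n d≤m)) ⟩
  sumBelow (d + (m ∸ d)) f                             ≡⟨ sumBelow-+ d (m ∸ d) f ⟩
  sumBelow d f + sumBelow (m ∸ d) (λ k → f (d + k))    ≡⟨ cong (sumBelow d f +_) tail≡0 ⟩
  sumBelow d f + 0                                     ≡⟨ +-identityʳ _ ⟩
  sumBelow d f                                         ∎)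
  where
  open ≡-Reasoning
  tail≡0 : sumBelow (m ∸ d) (λ k → f (d + k)) ≡ 0
  tail≡0 = sumBelow-vanishing (m ∸ d) (λ k _ → vanish (d + k) (m≤m+n d k))

sum-sumBelow-comm : ∀ {n} m (g : Fin n → ℕ → ℕ) →
                    ∑[ i < n ] sumBelow m (g i) ≡ sumBelow m (λ k → ∑[ i < n ] g i k)
sum-sumBelow-comm {n} zero    g = sum-replicate-zero n
sum-sumBelow-comm {n} (suc m) g =
  trans (∑-distrib-+ (λ i → sumBelow m (g i)) (λ i → g i m)) (cong (_+ ∑[ i < n ] g i m) (sum-sumBelow-comm m g))

sumBelow-𝟙 : ∀ H r (g : ℕ → ℕ) → sumBelow H (λ t → 𝟙[ r ≤ t ] * g t) ≡ sumBelow (H ∸ r) (λ k → g (r + k))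
sumBelow-𝟙 zero    r g = cong (λ x → sumBelow x (λ k → g (r + k))) (sym (0∸n≡0 r))
sumBelow-𝟙 (suc H) r g with r ≤? H
... | yes r≤H = begin
  sumBelow H (λ t → 𝟙[ r ≤ t ] * g t) + (g H + 0)      ≡⟨ cong₂ _+_ (sumBelow-𝟙 H r g) (+-identityʳ (g H)) ⟩
  sumBelow (H ∸ r) (λ k → g (r + k)) + g H             ≡⟨ cong (λ x → sumBelow (H ∸ r) (λ k → g (r + k)) + g x) (sym (m+[n∸m]≡n r≤H)) ⟩
  sumBelow (suc (H ∸ r)) (λ k → g (r + k))             ≡⟨ cong (λ x → sumBelow x (λ k → g (r + k))) (sym (+-∸-assoc 1 r≤H)) ⟩
  sumBelow (suc H ∸ r) (λ k → g (r + k))               ∎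
  where open ≡-Reasoning
... | no r≰H = begin
  sumBelow H (λ t → 𝟙[ r ≤ t ] * g t) + 0              ≡⟨ trans (+-identityʳ _) (sumBelow-𝟙 H r g) ⟩
  sumBelow (H ∸ r) (λ k → g (r + k))                   ≡⟨ cong (λ x → sumBelow x (λ k → g (r + k))) (trans (m≤n⇒m∸n≡0 (<⇒≤ H<r)) (sym (m≤n⇒m∸n≡0 H<r))) ⟩
  sumBelow (suc H ∸ r) (λ k → g (r + k))               ∎
  where
  open ≡-Reasoning
  H<r : H < r
  H<r = ≰⇒> r≰H

triangle : ℕ → ℕ → ℕ
triangle m f = sumBelow m (λ k → f ∸ k)

2*triangle[f,f]≡f*[1+f] : ∀ f → 2 * triangle f f ≡ f * suc f
2*triangle[f,f]≡f*[1+f] zero    = refl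
2*triangle[f,f]≡f*[1+f] (suc f) = begin
  2 * triangle (suc f) (suc f)        ≡⟨ cong (2 *_) triangle-suc ⟩
  2 * (suc f + triangle f f)          ≡⟨ *-distribˡ-+ 2 (suc f) (triangle f f) ⟩
  2 * suc f + 2 * triangle f f        ≡⟨ cong (2 * suc f +_) (2*triangle[f,f]≡f*[1+f] f) ⟩
  2 * suc f + f * suc f               ≡⟨ sym (*-distribʳ-+ (suc f) 2 f) ⟩
  (2 + f) * suc f                     ≡⟨ *-comm (2 + f) (suc f) ⟩
  suc f * suc (suc f)                 ∎
  where
  open ≡-Reasoning
  triangle-suc : triangle (suc f) (suc f) ≡ suc f + triangle f f
  triangle-suc = begin
    sumBelow (suc f) (λ k → suc f ∸ k)                       ≡⟨ sumBelow-cong (suc f) (λ k k≤f → +-∸-assoc 1 (≤-pred k≤f)) ⟩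
    sumBelow (suc f) (λ k → 1 + (f ∸ k))                     ≡⟨ sumBelow-distrib-+ (suc f) (λ _ → 1) (λ k → f ∸ k) ⟩
    sumBelow (suc f) (λ _ → 1) + (triangle f f + (f ∸ f))    ≡⟨ cong₂ _+_ (trans (sumBelow-const (suc f) 1) (*-identityʳ (suc f)))
                                                                           (trans (cong (triangle f f +_) (n∸n≡0 f)) (+-identityʳ _)) ⟩
    suc f + triangle f f                                     ∎

triangle≤square : ∀ m f → triangle m f ≤ f * f
triangle≤square m f = begin
  triangle m f                ≤⟨ sumBelow-truncate m f (λ k → f ∸ k) (λ k → m≤n⇒m∸n≡0) ⟩
  triangle f f                ≤⟨ sumBelow-mono-≤ f (λ k _ → m∸n≤m f k) ⟩
  sumBelow f (λ _ → f)        ≡⟨ sumBelow-const f f ⟩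
  f * f                       ∎
  where open ≤-Reasoning

square≤2*triangle : ∀ m f → f ≤ m → f * f ≤ 2 * triangle m f
square≤2*triangle m f f≤m = begin
  f * f              ≤⟨ *-monoʳ-≤ f (n≤1+n f) ⟩
  f * suc f          ≡⟨ sym (2*triangle[f,f]≡f*[1+f] f) ⟩
  2 * triangle f f   ≤⟨ *-monoʳ-≤ 2 (sumBelow-monoˡ-≤ (λ k → f ∸ k) f≤m) ⟩
  2 * triangle m f   ∎
  where open ≤-Reasoning

lastEnd≤ : ∀ {n} (a : ℕ → Maybe (Fin n)) i t → lastEnd a i t ≤ t
lastEnd≤ a i zero    = z≤n
lastEnd≤ a i (suc t) with isJob i (a t)
... | zero  = m≤n⇒m≤1+n (lastEnd≤ a i t)
... | suc _ = ≤-refl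

countBefore-lastEnd : ∀ {n} (a : ℕ → Maybe (Fin n)) i t → countBefore a i (lastEnd a i t) ≡ countBefore a i t
countBefore-lastEnd a i zero    = refl
countBefore-lastEnd a i (suc t) with isJob i (a t) in eq
... | zero  = trans (countBefore-lastEnd a i t) (sym (+-identityʳ _))
... | suc _ = cong (countBefore a i t +_) eq

lastEnd-runs : ∀ {n} (a : ℕ → Maybe (Fin n)) i t {u} → lastEnd a i t ≡ suc u → a u ≡ just i
lastEnd-runs a i (suc t) {u} e with isJob i (a t) in eq
... | zero  = lastEnd-runs a i t e
... | suc _ = subst (λ x → a x ≡ just i) (suc-injective e) (isJob≡suc⇒just i (a t) eq)

releasedWork : ∀ {n} (r p : Fin n → ℕ) → ℕ → ℕ
releasedWork {n} r p t = ∑[ i < n ] (𝟙[ r i ≤ t ] * p i)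

NonIdling : ∀ {n} {r p : Fin n → ℕ} → Schedule r p → Set
NonIdling {r = r} F = ∀ t → assign F t ≡ nothing → ∀ i → r i ≤ t → finishedBy F i t

module ScheduleFacts {n : ℕ} {r p : Fin n → ℕ} (p≥1 : ∀ i → 1 ≤ p i) (S : Schedule r p) where

  private
    a : ℕ → Maybe (Fin n)
    a = assign S
    h : ℕ
    h = horizon S
    c : Fin n → ℕ
    c = completion S

  done : Fin n → ℕ → ℕ
  done = countBefore a

  done-+ : ∀ i t m → done i (t + m) ≡ done i t + sumBelow m (λ k → isJob i (a (t + k)))
  done-+ i t zero    = trans (cong (done i) (+-identityʳ t)) (sym (+-identityʳ _))
  done-+ i t (suc m) = begin
    done i (t + suc m)                                                  ≡⟨ cong (done i) (+-suc t m) ⟩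
    done i (t + m) + isJob i (a (t + m))                                ≡⟨ cong (_+ isJob i (a (t + m))) (done-+ i t m) ⟩
    done i t + sumBelow m (λ k → isJob i (a (t + k))) + isJob i (a (t + m)) ≡⟨ +-assoc (done i t) _ _ ⟩
    done i t + sumBelow (suc m) (λ k → isJob i (a (t + k)))             ∎
    where open ≡-Reasoning

  done-mono : ∀ i {t s} → t ≤ s → done i t ≤ done i s
  done-mono i {t} {s} t≤s = begin
    done i t                                                     ≤⟨ m≤m+n _ _ ⟩
    done i t + sumBelow (s ∸ t) (λ k → isJob i (a (t + k)))     ≡⟨ sym (done-+ i t (s ∸ t)) ⟩
    done i (t + (s ∸ t))                                         ≡⟨ cong (done i) (m+[n∸m]≡n t≤s) ⟩
    done i s                                                     ∎
    where open ≤-Reasoning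

  done≤p : ∀ i t → done i t ≤ p i
  done≤p i t with ≤-total t h
  ... | inj₁ t≤h = subst (done i t ≤_) (exact S i) (done-mono i t≤h)
  ... | inj₂ h≤t = ≤-reflexive (begin
    done i t                                                     ≡⟨ cong (done i) (sym (m+[n∸m]≡n h≤t)) ⟩
    done i (h + (t ∸ h))                                         ≡⟨ done-+ i h (t ∸ h) ⟩
    done i h + sumBelow (t ∸ h) (λ k → isJob i (a (h + k)))     ≡⟨ cong (done i h +_) idle ⟩
    done i h + 0                                                 ≡⟨ trans (+-identityʳ _) (exact S i) ⟩
    p i                                                          ∎)
    where
    open ≡-Reasoning
    idle : sumBelow (t ∸ h) (λ k → isJob i (a (h + k))) ≡ 0
    idle = sumBelow-vanishing (t ∸ h) (λ k _ → cong (isJob i) (empty S (h + k) (m≤m+n h k)))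

  done≤elapsed : ∀ i t → done i t ≤ t ∸ r i
  done≤elapsed i zero    = z≤n
  done≤elapsed i (suc t) with isJob i (a t) in eq
  ... | zero  = begin
    done i t + 0     ≡⟨ +-identityʳ _ ⟩
    done i t         ≤⟨ done≤elapsed i t ⟩
    t ∸ r i          ≤⟨ ∸-monoˡ-≤ (r i) (n≤1+n t) ⟩
    suc t ∸ r i      ∎
    where open ≤-Reasoning
  ... | suc k = begin
    done i t + suc k ≡⟨ cong (done i t +_) (sym eq) ⟩
    done i t + isJob i (a t) ≤⟨ +-monoʳ-≤ (done i t) (isJob≤1 i (a t)) ⟩
    done i t + 1     ≡⟨ +-comm (done i t) 1 ⟩
    suc (done i t)   ≤⟨ s≤s (done≤elapsed i t) ⟩
    suc (t ∸ r i)    ≡⟨ sym (+-∸-assoc 1 (released S i t (isJob≡suc⇒just i (a t) eq))) ⟩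
    suc t ∸ r i      ∎
    where open ≤-Reasoning

  done-unreleased : ∀ i {t} → t ≤ r i → done i t ≡ 0
  done-unreleased i {t} t≤r = n≤0⇒n≡0 (≤-trans (done≤elapsed i t) (≤-reflexive (m≤n⇒m∸n≡0 t≤r)))

  done-completion : ∀ i → done i (c i) ≡ p i
  done-completion i = trans (countBefore-lastEnd a i h) (exact S i)

  completion≤horizon : ∀ i → c i ≤ h
  completion≤horizon i = lastEnd≤ a i h

  lastSlot : ∀ i → ∃[ u ] (c i ≡ suc u)
  lastSlot i with c i in eq
  ... | suc u = u , refl
  ... | zero  = contradiction (trans (sym (done-completion i)) (cong (done i) eq)) (≢-sym (<⇒≢ (p≥1 i)))

  runs-lastSlot : ∀ i → a (proj₁ (lastSlot i)) ≡ just i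
  runs-lastSlot i = lastEnd-runs a i h (proj₂ (lastSlot i))

  done-after-completion : ∀ i {s} → c i ≤ s → done i s ≡ p i
  done-after-completion i {s} c≤s = ≤-antisym (done≤p i s) (subst (_≤ done i s) (done-completion i) (done-mono i c≤s))

  done-before-completion : ∀ i {s} → s < c i → done i s < p i
  done-before-completion i {s} s<c with lastSlot i | runs-lastSlot i
  ... | u , c≡1+u | runs-u = begin-strict
    done i s                      ≤⟨ done-mono i (≤-pred (subst (s <_) c≡1+u s<c)) ⟩
    done i u                      <⟨ n<1+n _ ⟩
    suc (done i u)                ≡⟨ +-comm 1 (done i u) ⟩
    done i u + 1                  ≡⟨ cong (done i u +_) (sym (trans (cong (isJob i) runs-u) (isJob-self i))) ⟩
    done i (suc u)                ≡⟨ cong (done i) (sym c≡1+u) ⟩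
    done i (c i)                  ≡⟨ done-completion i ⟩
    p i                           ∎
    where open ≤-Reasoning

  started : ∀ i t → 0 < done i t → ∃[ u ] (u < t × a u ≡ just i)
  started i (suc t) done>0 with isJob i (a t) in eq
  ... | suc _ = t , ≤-refl , isJob≡suc⇒just i (a t) eq
  ... | zero with started i t (subst (0 <_) (+-identityʳ _) done>0)
  ...   | u , u<t , runs-u = u , m<n⇒m<1+n u<t , runs-u

  remaining≤time-left : ∀ i t → p i ∸ done i t ≤ c i ∸ t
  remaining≤time-left i t with ≤-total (c i) t
  ... | inj₁ c≤t = subst (_≤ c i ∸ t) (sym (trans (cong (p i ∸_) (done-after-completion i c≤t)) (n∸n≡0 (p i)))) z≤n
  ... | inj₂ t≤c = m≤n+o⇒m∸n≤o (p i) (done i t) (begin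
    p i                                                              ≡⟨ sym (done-completion i) ⟩
    done i (c i)                                                     ≡⟨ cong (done i) (sym (m+[n∸m]≡n t≤c)) ⟩
    done i (t + (c i ∸ t))                                           ≡⟨ done-+ i t (c i ∸ t) ⟩
    done i t + sumBelow (c i ∸ t) (λ k → isJob i (a (t + k)))        ≤⟨ +-monoʳ-≤ (done i t) (sumBelow≤length (c i ∸ t) (λ k → isJob≤1 i (a (t + k)))) ⟩
    done i t + (c i ∸ t)                                             ∎)
    where open ≤-Reasoning

  workDone : ℕ → ℕ
  workDone t = ∑[ i < n ] done i t

  remainingWork : ℕ → ℕ
  remainingWork t = ∑[ i < n ] (𝟙[ r i ≤ t ] * (p i ∸ done i t))

  remainingWorkAt : ℕ → ℕ → ℕ
  remainingWorkAt t s = ∑[ i < n ] (𝟙[ r i ≤ t ] * (p i ∸ done i s))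

  residualFlow : ℕ → ℕ
  residualFlow t = ∑[ i < n ] (𝟙[ r i ≤ t ] * (c i ∸ t))

  workDone-suc : ∀ t → workDone (suc t) ≡ workDone t + ∑[ i < n ] isJob i (a t)
  workDone-suc t = ∑-distrib-+ (λ i → done i t) (λ i → isJob i (a t))

  remainingWork≡releasedWork∸workDone : ∀ t → remainingWork t ≡ releasedWork r p t ∸ workDone t
  remainingWork≡releasedWork∸workDone t = begin
    remainingWork t                                   ≡⟨ sym (m+n∸n≡m (remainingWork t) (workDone t)) ⟩
    remainingWork t + workDone t ∸ workDone t         ≡⟨ cong (_∸ workDone t) (sym (∑-distrib-+ _ (λ i → done i t))) ⟩
    ∑[ i < n ] (𝟙[ r i ≤ t ] * (p i ∸ done i t) + done i t) ∸ workDone t ≡⟨ cong (_∸ workDone t) (sum-cong-≗ term) ⟩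
    releasedWork r p t ∸ workDone t                   ∎
    where
    open ≡-Reasoning
    term : ∀ i → 𝟙[ r i ≤ t ] * (p i ∸ done i t) + done i t ≡ 𝟙[ r i ≤ t ] * p i
    term i with r i ≤? t
    ... | yes _   = trans (cong₂ _+_ (*-identityˡ (p i ∸ done i t)) refl) (trans (m∸n+n≡m (done≤p i t)) (sym (*-identityˡ (p i))))
    ... | no r≰t = done-unreleased i (<⇒≤ (≰⇒> r≰t))

  sumBelow-residualFlow : ∀ H → sumBelow H residualFlow ≡ ∑[ i < n ] triangle (H ∸ r i) (flow S i)
  sumBelow-residualFlow H = begin
    sumBelow H residualFlow                                            ≡⟨ sym (sum-sumBelow-comm H (λ i t → 𝟙[ r i ≤ t ] * (c i ∸ t))) ⟩
    ∑[ i < n ] sumBelow H (λ t → 𝟙[ r i ≤ t ] * (c i ∸ t))            ≡⟨ sum-cong-≗ (λ i → sumBelow-𝟙 H (r i) (λ t → c i ∸ t)) ⟩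
    ∑[ i < n ] sumBelow (H ∸ r i) (λ k → c i ∸ (r i + k))              ≡⟨ sum-cong-≗ (λ i → sumBelow-cong (H ∸ r i) (λ k _ → sym (∸-+-assoc (c i) (r i) k))) ⟩
    ∑[ i < n ] triangle (H ∸ r i) (flow S i)                           ∎
    where open ≡-Reasoning

  cost≡ : cost S ≡ ∑[ i < n ] (flow S i * flow S i)
  cost≡ = sum-tabulate (λ i → flow S i * flow S i)

  cost≤2*sumBelow-residualFlow : ∀ H → h ≤ H → cost S ≤ 2 * sumBelow H residualFlow
  cost≤2*sumBelow-residualFlow H h≤H = begin
    cost S                                          ≡⟨ cost≡ ⟩
    ∑[ i < n ] (flow S i * flow S i)                ≤⟨ sum-mono-≤ (λ i → square≤2*triangle (H ∸ r i) (flow S i) (flow≤ i)) ⟩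
    ∑[ i < n ] (2 * triangle (H ∸ r i) (flow S i))  ≡⟨ sym (*-distribˡ-sum 2 (λ i → triangle (H ∸ r i) (flow S i))) ⟩
    2 * ∑[ i < n ] triangle (H ∸ r i) (flow S i)    ≡⟨ cong (2 *_) (sym (sumBelow-residualFlow H)) ⟩
    2 * sumBelow H residualFlow                     ∎
    where
    open ≤-Reasoning
    flow≤ : ∀ i → flow S i ≤ H ∸ r i
    flow≤ i = ∸-monoˡ-≤ (r i) (≤-trans (completion≤horizon i) h≤H)

  sumBelow-residualFlow≤cost : ∀ H → sumBelow H residualFlow ≤ cost S
  sumBelow-residualFlow≤cost H = begin
    sumBelow H residualFlow                         ≡⟨ sumBelow-residualFlow H ⟩
    ∑[ i < n ] triangle (H ∸ r i) (flow S i)        ≤⟨ sum-mono-≤ (λ i → triangle≤square (H ∸ r i) (flow S i)) ⟩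
    ∑[ i < n ] (flow S i * flow S i)                ≡⟨ sym cost≡ ⟩
    cost S                                          ∎
    where open ≤-Reasoning

  workDone-window≤length : ∀ t k → ∑[ i < n ] (done i (t + k) ∸ done i t) ≤ k
  workDone-window≤length t k = begin
    ∑[ i < n ] (done i (t + k) ∸ done i t)               ≡⟨ sum-cong-≗ (λ i → trans (cong (_∸ done i t) (done-+ i t k)) (m+n∸m≡n (done i t) _)) ⟩
    ∑[ i < n ] sumBelow k (λ j → isJob i (a (t + j)))    ≡⟨ sum-sumBelow-comm k (λ i j → isJob i (a (t + j))) ⟩
    sumBelow k (λ j → ∑[ i < n ] isJob i (a (t + j)))    ≤⟨ sumBelow≤length k (λ j → sum-isJob≤1 (a (t + j))) ⟩
    k                                                    ∎
    where open ≤-Reasoning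

  remainingWork-drain : ∀ t k → remainingWork t ≤ remainingWorkAt t (t + k) + k
  remainingWork-drain t k = begin
    remainingWork t                                                                     ≤⟨ sum-mono-≤ term ⟩
    ∑[ i < n ] (𝟙[ r i ≤ t ] * (p i ∸ done i (t + k)) + (done i (t + k) ∸ done i t))  ≡⟨ ∑-distrib-+ _ (λ i → done i (t + k) ∸ done i t) ⟩
    remainingWorkAt t (t + k) + ∑[ i < n ] (done i (t + k) ∸ done i t)                 ≤⟨ +-monoʳ-≤ _ (workDone-window≤length t k) ⟩
    remainingWorkAt t (t + k) + k                                                       ∎
    where
    open ≤-Reasoning
    term : ∀ i → 𝟙[ r i ≤ t ] * (p i ∸ done i t) ≤ 𝟙[ r i ≤ t ] * (p i ∸ done i (t + k)) + (done i (t + k) ∸ done i t)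
    term i with r i ≤? t
    ... | no _  = z≤n
    ... | yes _ = subst₂ _≤_ (sym (*-identityˡ (p i ∸ done i t)))
                    (cong (_+ (done i (t + k) ∸ done i t)) (sym (*-identityˡ (p i ∸ done i (t + k)))))
                    (∸-triangle (p i) (done-mono i (m≤m+n t k)))

  remainingWorkAt-horizon : ∀ t → remainingWorkAt t (t + h) ≡ 0
  remainingWorkAt-horizon t = trans (sum-cong-≗ finished) (sum-replicate-zero n)
    where
    finished : ∀ i → 𝟙[ r i ≤ t ] * (p i ∸ done i (t + h)) ≡ 0
    finished i = begin
      𝟙[ r i ≤ t ] * (p i ∸ done i (t + h))  ≡⟨ cong (λ x → 𝟙[ r i ≤ t ] * (p i ∸ x)) (done-after-completion i (≤-trans (completion≤horizon i) (m≤n+m h t))) ⟩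
      𝟙[ r i ≤ t ] * (p i ∸ p i)             ≡⟨ cong (𝟙[ r i ≤ t ] *_) (n∸n≡0 (p i)) ⟩
      𝟙[ r i ≤ t ] * 0                       ≡⟨ *-zeroʳ 𝟙[ r i ≤ t ] ⟩
      0                                      ∎
      where open ≡-Reasoning

  remainingWork≤horizon : ∀ t → remainingWork t ≤ h
  remainingWork≤horizon t = subst (λ x → remainingWork t ≤ x + h) (remainingWorkAt-horizon t) (remainingWork-drain t h)

  pmin*remainingWork≤pmax*residualFlow : ∀ pmin pmax → (∀ i → pmin ≤ p i) → (∀ i → p i ≤ pmax) → ∀ t →
                                          pmin * remainingWork t ≤ pmax * residualFlow t
  pmin*remainingWork≤pmax*residualFlow pmin pmax pmin≤p p≤pmax t = begin
    pmin * remainingWork t                                    ≡⟨ *-distribˡ-sum pmin (λ i → 𝟙[ r i ≤ t ] * (p i ∸ done i t)) ⟩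
    ∑[ i < n ] (pmin * (𝟙[ r i ≤ t ] * (p i ∸ done i t)))    ≤⟨ sum-mono-≤ (λ i → *-mono-≤ (≤-trans (pmin≤p i) (p≤pmax i))
                                                                   (*-monoʳ-≤ 𝟙[ r i ≤ t ] (remaining≤time-left i t))) ⟩
    ∑[ i < n ] (pmax * (𝟙[ r i ≤ t ] * (c i ∸ t)))           ≡⟨ sym (*-distribˡ-sum pmax (λ i → 𝟙[ r i ≤ t ] * (c i ∸ t))) ⟩
    pmax * residualFlow t                                     ∎
    where open ≤-Reasoning

  sumBelow-remainingWorkAt≤ : ∀ pmax → (∀ i → p i ≤ pmax) → ∀ t →
                              sumBelow h (λ k → remainingWorkAt t (t + k)) ≤ pmax * residualFlow t
  sumBelow-remainingWorkAt≤ pmax p≤pmax t = begin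
    sumBelow h (λ k → remainingWorkAt t (t + k))                          ≡⟨ sym (sum-sumBelow-comm h (λ i k → 𝟙[ r i ≤ t ] * (p i ∸ done i (t + k)))) ⟩
    ∑[ i < n ] sumBelow h (λ k → 𝟙[ r i ≤ t ] * (p i ∸ done i (t + k)))   ≡⟨ sum-cong-≗ (λ i → sym (*-distribˡ-sumBelow h 𝟙[ r i ≤ t ] (λ k → p i ∸ done i (t + k)))) ⟩
    ∑[ i < n ] (𝟙[ r i ≤ t ] * sumBelow h (λ k → p i ∸ done i (t + k)))   ≤⟨ sum-mono-≤ (λ i → *-monoʳ-≤ 𝟙[ r i ≤ t ] (job i)) ⟩
    ∑[ i < n ] (𝟙[ r i ≤ t ] * (pmax * (c i ∸ t)))                       ≡⟨ sum-cong-≗ (λ i → x∙yz≈y∙xz 𝟙[ r i ≤ t ] pmax (c i ∸ t)) ⟩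
    ∑[ i < n ] (pmax * (𝟙[ r i ≤ t ] * (c i ∸ t)))                       ≡⟨ sym (*-distribˡ-sum pmax (λ i → 𝟙[ r i ≤ t ] * (c i ∸ t))) ⟩
    pmax * residualFlow t                                                 ∎
    where
    open ≤-Reasoning
    job : ∀ i → sumBelow h (λ k → p i ∸ done i (t + k)) ≤ pmax * (c i ∸ t)
    job i = begin
      sumBelow h (λ k → p i ∸ done i (t + k))          ≤⟨ sumBelow-truncate h (c i ∸ t) _ finished ⟩
      sumBelow (c i ∸ t) (λ k → p i ∸ done i (t + k))  ≤⟨ sumBelow-mono-≤ (c i ∸ t) (λ k _ → ≤-trans (m∸n≤m (p i) (done i (t + k))) (p≤pmax i)) ⟩
      sumBelow (c i ∸ t) (λ _ → pmax)                  ≡⟨ trans (sumBelow-const (c i ∸ t) pmax) (*-comm (c i ∸ t) pmax) ⟩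
      pmax * (c i ∸ t)                                 ∎
      where
      finished : ∀ k → c i ∸ t ≤ k → p i ∸ done i (t + k) ≡ 0
      finished k c-t≤k = trans (cong (p i ∸_) (done-after-completion i (≤-trans (m≤n+m∸n (c i) t) (+-monoʳ-≤ t c-t≤k))))
                               (n∸n≡0 (p i))

  remainingWork²≤2*pmax*residualFlow : ∀ pmax → (∀ i → p i ≤ pmax) → ∀ t →
                                        remainingWork t * remainingWork t ≤ 2 * pmax * residualFlow t
  remainingWork²≤2*pmax*residualFlow pmax p≤pmax t = begin
    V * V                                           ≤⟨ square≤2*triangle h V (remainingWork≤horizon t) ⟩
    2 * triangle h V                                ≤⟨ *-monoʳ-≤ 2 (sumBelow-mono-≤ h (λ k _ → drain k)) ⟩
    2 * sumBelow h (λ k → remainingWorkAt t (t + k)) ≤⟨ *-monoʳ-≤ 2 (sumBelow-remainingWorkAt≤ pmax p≤pmax t) ⟩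
    2 * (pmax * residualFlow t)                     ≡⟨ sym (*-assoc 2 pmax (residualFlow t)) ⟩
    2 * pmax * residualFlow t                       ∎
    where
    open ≤-Reasoning
    V : ℕ
    V = remainingWork t
    drain : ∀ k → V ∸ k ≤ remainingWorkAt t (t + k)
    drain k = m≤n+o⇒m∸n≤o V k (subst (V ≤_) (+-comm (remainingWorkAt t (t + k)) k) (remainingWork-drain t k))

module FCFSFacts {n : ℕ} {r p : Fin n → ℕ} (p≥1 : ∀ i → 1 ≤ p i) (S : Schedule r p) (fcfs : IsFCFS S) where

  open ScheduleFacts p≥1 S
  open IsFCFS fcfs

  private
    a : ℕ → Maybe (Fin n)
    a = assign S
    c : Fin n → ℕ
    c = completion S

  alive : ℕ → ℕ
  alive t = ∑[ i < n ] (𝟙[ r i ≤ t ] * 𝟙[ suc t ≤ c i ])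

  runs-released : ∀ i t s → r i ≤ t → t ≤ s → s < c i → ∃[ j ] (a s ≡ just j × r j ≤ t)
  runs-released i t s r≤t t≤s s<c with a s in eq
  ... | nothing = contradiction (nonIdling s eq i (≤-trans r≤t t≤s)) (<⇒≢ (done-before-completion i s<c))
  ... | just j with r j ≤? t
  ...   | yes rj≤t = j , refl , rj≤t
  ...   | no rj≰t  = contradiction (releaseOrder j i s eq (≤-<-trans r≤t (≰⇒> rj≰t))) (<⇒≢ (done-before-completion i s<c))

  time-left≤remainingWork : ∀ i t → r i ≤ t → t < c i → c i ∸ t ≤ remainingWork t
  time-left≤remainingWork i t r≤t t<c = begin
    c i ∸ t                                                               ≡⟨ sym (trans (sumBelow-const (c i ∸ t) 1) (*-identityʳ _)) ⟩
    sumBelow (c i ∸ t) (λ _ → 1)                                          ≤⟨ sumBelow-mono-≤ (c i ∸ t) (λ k k< → busy (t + k) (m≤m+n t k) (window k k<)) ⟩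
    sumBelow (c i ∸ t) (λ k → ∑[ j < n ] (𝟙[ r j ≤ t ] * isJob j (a (t + k)))) ≡⟨ sym (sum-sumBelow-comm (c i ∸ t) (λ j k → 𝟙[ r j ≤ t ] * isJob j (a (t + k)))) ⟩
    ∑[ j < n ] sumBelow (c i ∸ t) (λ k → 𝟙[ r j ≤ t ] * isJob j (a (t + k))) ≡⟨ sum-cong-≗ (λ j → sym (*-distribˡ-sumBelow (c i ∸ t) 𝟙[ r j ≤ t ] (λ k → isJob j (a (t + k))))) ⟩
    ∑[ j < n ] (𝟙[ r j ≤ t ] * sumBelow (c i ∸ t) (λ k → isJob j (a (t + k)))) ≤⟨ sum-mono-≤ (λ j → *-monoʳ-≤ 𝟙[ r j ≤ t ] (window-work j)) ⟩
    remainingWork t                                                       ∎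
    where
    open ≤-Reasoning
    window : ∀ k → k < c i ∸ t → t + k < c i
    window k k< = subst (t + k <_) (m+[n∸m]≡n (<⇒≤ t<c)) (+-monoʳ-< t k<)
    busy : ∀ s → t ≤ s → s < c i → 1 ≤ ∑[ j < n ] (𝟙[ r j ≤ t ] * isJob j (a s))
    busy s t≤s s<c with runs-released i t s r≤t t≤s s<c
    ... | j , runs-j , rj≤t = ≤-reflexive (sym (begin-equality
      ∑[ j′ < n ] (𝟙[ r j′ ≤ t ] * isJob j′ (a s))  ≡⟨ cong (λ x → ∑[ j′ < n ] (𝟙[ r j′ ≤ t ] * isJob j′ x)) runs-j ⟩
      ∑[ j′ < n ] (𝟙[ r j′ ≤ t ] * isJob j′ (just j)) ≡⟨ sum-isJob (λ j′ → 𝟙[ r j′ ≤ t ]) j ⟩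
      𝟙[ r j ≤ t ]                                   ≡⟨ 𝟙-yes rj≤t ⟩
      1                                              ∎))
    window-work : ∀ j → sumBelow (c i ∸ t) (λ k → isJob j (a (t + k))) ≤ p j ∸ done j t
    window-work j = subst (_≤ p j ∸ done j t) (trans (cong (_∸ done j t) (done-+ j t (c i ∸ t))) (m+n∸m≡n (done j t) _))
                      (∸-monoˡ-≤ (done j t) (done≤p j (t + (c i ∸ t))))

  residualFlow≤alive*remainingWork : ∀ t → residualFlow t ≤ alive t * remainingWork t
  residualFlow≤alive*remainingWork t = begin
    residualFlow t                                                      ≤⟨ sum-mono-≤ job ⟩
    ∑[ i < n ] (𝟙[ r i ≤ t ] * 𝟙[ suc t ≤ c i ] * remainingWork t)     ≡⟨ sym (*-distribʳ-sum (remainingWork t) (λ i → 𝟙[ r i ≤ t ] * 𝟙[ suc t ≤ c i ])) ⟩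
    alive t * remainingWork t                                           ∎
    where
    open ≤-Reasoning
    job : ∀ i → 𝟙[ r i ≤ t ] * (c i ∸ t) ≤ 𝟙[ r i ≤ t ] * 𝟙[ suc t ≤ c i ] * remainingWork t
    job i with r i ≤? t | suc t ≤? c i
    ... | no _    | _       = z≤n
    ... | yes _   | no t≮c  = ≤-reflexive (trans (+-identityʳ (c i ∸ t)) (m≤n⇒m∸n≡0 (≮⇒≥ t≮c)))
    ... | yes r≤t | yes t<c = subst₂ _≤_ (sym (*-identityˡ (c i ∸ t))) (sym (*-identityˡ (remainingWork t)))
                                (time-left≤remainingWork i t r≤t t<c)

  -- An alive job that started before t is not preempted, so it is the one running at t.
  alive*pmin≤pmin+remainingWork : ∀ pmin → (∀ i → pmin ≤ p i) → ∀ t → alive t * pmin ≤ pmin + remainingWork t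
  alive*pmin≤pmin+remainingWork pmin pmin≤p t = begin
    alive t * pmin                                                           ≡⟨ *-distribʳ-sum pmin (λ i → 𝟙[ r i ≤ t ] * 𝟙[ suc t ≤ c i ]) ⟩
    ∑[ i < n ] (𝟙[ r i ≤ t ] * 𝟙[ suc t ≤ c i ] * pmin)                      ≤⟨ sum-mono-≤ job ⟩
    ∑[ i < n ] (𝟙[ r i ≤ t ] * (p i ∸ done i t) + pmin * isJob i (a t))     ≡⟨ ∑-distrib-+ _ (λ i → pmin * isJob i (a t)) ⟩
    remainingWork t + ∑[ i < n ] (pmin * isJob i (a t))                      ≡⟨ cong (remainingWork t +_) (sym (*-distribˡ-sum pmin (λ i → isJob i (a t)))) ⟩
    remainingWork t + pmin * ∑[ i < n ] isJob i (a t)                        ≤⟨ +-monoʳ-≤ (remainingWork t) (*-monoʳ-≤ pmin (sum-isJob≤1 (a t))) ⟩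
    remainingWork t + pmin * 1                                               ≡⟨ trans (cong (remainingWork t +_) (*-identityʳ pmin)) (+-comm (remainingWork t) pmin) ⟩
    pmin + remainingWork t                                                   ∎
    where
    open ≤-Reasoning
    job : ∀ i → 𝟙[ r i ≤ t ] * 𝟙[ suc t ≤ c i ] * pmin ≤ 𝟙[ r i ≤ t ] * (p i ∸ done i t) + pmin * isJob i (a t)
    job i with r i ≤? t | suc t ≤? c i
    ... | no _  | _       = z≤n
    ... | yes _ | no _    = z≤n
    ... | yes _ | yes t<c with done i t in done≡
    ...   | zero  = subst₂ _≤_ (sym (*-identityˡ pmin)) (cong (_+ pmin * isJob i (a t)) (sym (*-identityˡ (p i))))
                      (≤-trans (pmin≤p i) (m≤m+n (p i) _))
    ...   | suc d with started i t (subst (0 <_) (sym done≡) z<s) | lastSlot i | runs-lastSlot i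
    ...     | u , u<t , runs-u | v , c≡1+v | runs-v = begin
      1 * pmin                                     ≡⟨ trans (*-identityˡ pmin) (sym (*-identityʳ pmin)) ⟩
      pmin * 1                                     ≡⟨ cong (pmin *_) (sym (trans (cong (isJob i) runs-t) (isJob-self i))) ⟩
      pmin * isJob i (a t)                         ≤⟨ m≤n+m _ _ ⟩
      1 * (p i ∸ suc d) + pmin * isJob i (a t)     ∎
      where
      runs-t : a t ≡ just i
      runs-t = nonPreemptive i u t v runs-u runs-v (<⇒≤ u<t) (≤-pred (subst (suc t ≤_) c≡1+v t<c))

  pmin*residualFlow≤[pmin+remainingWork]*remainingWork :
    ∀ pmin → (∀ i → pmin ≤ p i) → ∀ t → pmin * residualFlow t ≤ (pmin + remainingWork t) * remainingWork t
  pmin*residualFlow≤[pmin+remainingWork]*remainingWork pmin pmin≤p t = begin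
    pmin * residualFlow t                   ≤⟨ *-monoʳ-≤ pmin (residualFlow≤alive*remainingWork t) ⟩
    pmin * (alive t * remainingWork t)      ≡⟨ sym (*-assoc pmin (alive t) (remainingWork t)) ⟩
    pmin * alive t * remainingWork t        ≡⟨ cong (_* remainingWork t) (*-comm pmin (alive t)) ⟩
    alive t * pmin * remainingWork t        ≤⟨ *-monoˡ-≤ (remainingWork t) (alive*pmin≤pmin+remainingWork pmin pmin≤p t) ⟩
    (pmin + remainingWork t) * remainingWork t ∎
    where open ≤-Reasoning

module _ {n : ℕ} {r p : Fin n → ℕ} (p≥1 : ∀ i → 1 ≤ p i) where

  open ScheduleFacts {r = r} p≥1

  workDone≤workDone-nonIdling : (F : Schedule r p) → NonIdling F → (S : Schedule r p) → ∀ t → workDone S t ≤ workDone F t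
  workDone≤workDone-nonIdling F nonIdling S zero    = ≤-reflexive (trans (sum-replicate-zero n) (sym (sum-replicate-zero n)))
  workDone≤workDone-nonIdling F nonIdling S (suc t) = step (assign F t) refl
    where
    open ≤-Reasoning
    IH : workDone S t ≤ workDone F t
    IH = workDone≤workDone-nonIdling F nonIdling S t
    step : ∀ x → assign F t ≡ x → workDone S (suc t) ≤ workDone F (suc t)
    step (just k) runs-k = begin
      workDone S (suc t)                              ≡⟨ workDone-suc S t ⟩
      workDone S t + ∑[ i < n ] isJob i (assign S t)  ≤⟨ +-mono-≤ IH (sum-isJob≤1 (assign S t)) ⟩
      workDone F t + 1                                ≡⟨ cong (workDone F t +_) (sym (trans (sum-cong-≗ (λ i → cong (isJob i) runs-k)) (sum-isJob-just k))) ⟩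
      workDone F t + ∑[ i < n ] isJob i (assign F t)  ≡⟨ sym (workDone-suc F t) ⟩
      workDone F (suc t)                              ∎
    step nothing idle = begin
      workDone S (suc t)                              ≤⟨ sum-mono-≤ done-S ⟩
      releasedWork r p t                              ≤⟨ sum-mono-≤ done-F ⟩
      workDone F t                                    ≡⟨ sym (trans (workDone-suc F t) (trans (cong (workDone F t +_) nothing-runs) (+-identityʳ _))) ⟩
      workDone F (suc t)                              ∎
      where
      nothing-runs : ∑[ i < n ] isJob i (assign F t) ≡ 0
      nothing-runs = trans (sum-cong-≗ (λ i → cong (isJob i) idle)) (sum-replicate-zero n)
      done-S : ∀ i → done S i (suc t) ≤ 𝟙[ r i ≤ t ] * p i
      done-S i with r i ≤? t
      ... | yes _   = subst (done S i (suc t) ≤_) (sym (*-identityˡ (p i))) (done≤p S i (suc t))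
      ... | no r≰t = ≤-reflexive (done-unreleased S i (≰⇒> r≰t))
      done-F : ∀ i → 𝟙[ r i ≤ t ] * p i ≤ done F i t
      done-F i with r i ≤? t
      ... | yes r≤t = ≤-reflexive (trans (*-identityˡ (p i)) (sym (nonIdling t idle i r≤t)))
      ... | no _    = z≤n

  remainingWork-nonIdling≤remainingWork : (F : Schedule r p) → NonIdling F → (S : Schedule r p) →
                                          ∀ t → remainingWork F t ≤ remainingWork S t
  remainingWork-nonIdling≤remainingWork F nonIdling S t = begin
    remainingWork F t                   ≡⟨ remainingWork≡releasedWork∸workDone F t ⟩
    releasedWork r p t ∸ workDone F t   ≤⟨ ∸-monoʳ-≤ (releasedWork r p t) (workDone≤workDone-nonIdling F nonIdling S t) ⟩
    releasedWork r p t ∸ workDone S t   ≡⟨ sym (remainingWork≡releasedWork∸workDone S t) ⟩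
    remainingWork S t                   ∎
    where open ≤-Reasoning

  pmin*residualFlow-fcfs≤3*pmax*residualFlow : (F : Schedule r p) → IsFCFS F → (S : Schedule r p) →
                       ∀ pmin pmax → (∀ i → pmin ≤ p i) → (∀ i → p i ≤ pmax) → ∀ t →
                       pmin * residualFlow F t ≤ 3 * pmax * residualFlow S t
  pmin*residualFlow-fcfs≤3*pmax*residualFlow F fcfs S pmin pmax pmin≤p p≤pmax t = begin
    pmin * residualFlow F t                          ≤⟨ FCFSFacts.pmin*residualFlow≤[pmin+remainingWork]*remainingWork p≥1 F fcfs pmin pmin≤p t ⟩
    (pmin + remainingWork F t) * remainingWork F t   ≤⟨ *-mono-≤ (+-monoʳ-≤ pmin V-F≤V-S) V-F≤V-S ⟩
    (pmin + remainingWork S t) * remainingWork S t   ≡⟨ *-distribʳ-+ (remainingWork S t) pmin (remainingWork S t) ⟩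
    pmin * remainingWork S t + remainingWork S t * remainingWork S t
                                                     ≤⟨ +-mono-≤ (pmin*remainingWork≤pmax*residualFlow S pmin pmax pmin≤p p≤pmax t)
                                                                 (remainingWork²≤2*pmax*residualFlow S pmax p≤pmax t) ⟩
    pmax * residualFlow S t + 2 * pmax * residualFlow S t
                                                     ≡⟨ solve 2 (λ m d → m :* d :+ con 2 :* m :* d := con 3 :* m :* d) refl pmax (residualFlow S t) ⟩
    3 * pmax * residualFlow S t                      ∎
    where
    open ≤-Reasoning
    open +-*-Solver
    V-F≤V-S : remainingWork F t ≤ remainingWork S t
    V-F≤V-S = remainingWork-nonIdling≤remainingWork F (IsFCFS.nonIdling fcfs) S t

  cost-fcfs*pmin≤6*pmax*cost : (F : Schedule r p) → IsFCFS F → (S : Schedule r p) →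
               ∀ pmin pmax → (∀ i → pmin ≤ p i) → (∀ i → p i ≤ pmax) →
               cost F * pmin ≤ 6 * pmax * cost S
  cost-fcfs*pmin≤6*pmax*cost F fcfs S pmin pmax pmin≤p p≤pmax = begin
    cost F * pmin                                      ≡⟨ *-comm (cost F) pmin ⟩
    pmin * cost F                                      ≤⟨ *-monoʳ-≤ pmin (cost≤2*sumBelow-residualFlow F H (m≤m+n _ _)) ⟩
    pmin * (2 * sumBelow H (residualFlow F))           ≡⟨ x∙yz≈y∙xz pmin 2 _ ⟩
    2 * (pmin * sumBelow H (residualFlow F))           ≡⟨ cong (2 *_) (*-distribˡ-sumBelow H pmin (residualFlow F)) ⟩
    2 * sumBelow H (λ t → pmin * residualFlow F t)     ≤⟨ *-monoʳ-≤ 2 (sumBelow-mono-≤ H (λ t _ → pmin*residualFlow-fcfs≤3*pmax*residualFlow F fcfs S pmin pmax pmin≤p p≤pmax t)) ⟩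
    2 * sumBelow H (λ t → 3 * pmax * residualFlow S t) ≡⟨ cong (2 *_) (sym (*-distribˡ-sumBelow H (3 * pmax) (residualFlow S))) ⟩
    2 * (3 * pmax * sumBelow H (residualFlow S))       ≤⟨ *-monoʳ-≤ 2 (*-monoʳ-≤ (3 * pmax) (sumBelow-residualFlow≤cost S H)) ⟩
    2 * (3 * pmax * cost S)                            ≡⟨ solve 2 (λ m x → con 2 :* (con 3 :* m :* x) := con 6 :* m :* x) refl pmax (cost S) ⟩
    6 * pmax * cost S                                  ∎
    where
    open ≤-Reasoning
    open +-*-Solver
    H : ℕ
    H = horizon F + horizon S

foldr-⊓-tabulate≤ : ∀ {m} b (q : Fin m → ℕ) j → foldr _⊓_ b (tabulate q) ≤ q j
foldr-⊓-tabulate≤ b q zero    = m⊓n≤m _ _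
foldr-⊓-tabulate≤ b q (suc j) = ≤-trans (m⊓n≤n _ _) (foldr-⊓-tabulate≤ b (q ∘ suc) j)

minP≤ : ∀ {n} (p : Fin n → ℕ) i → minP p ≤ p i
minP≤ {suc n} p i = foldr-⊓-tabulate≤ (p zero) p i

≤maxP : ∀ {n} (p : Fin n → ℕ) i → p i ≤ maxP p
≤maxP p zero    = m≤m⊔n _ _
≤maxP p (suc i) = m≤n⇒m≤o⊔n (p zero) (≤maxP (p ∘ suc) i)

theoremE2 : ∃[ K ] (∀ (n : ℕ) (r p : Fin n → ℕ) → (∀ i → 1 ≤ p i) →
              (fcfs : Schedule r p) → IsFCFS fcfs → (S : Schedule r p) →
              cost fcfs * minP p ≤ K * maxP p * cost S)
theoremE2 = 6 , λ n r p p≥1 F fcfs S → cost-fcfs*pmin≤6*pmax*cost p≥1 F fcfs S (minP p) (maxP p) (minP≤ p) (≤maxP p)
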